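{- For every $n\geq 0$, the tally-sequences of the vertices of the tournament $T_n$ are pairwise distinct.
   Context: For a nonzero integer $z$, $\mathsf{odd}(z)$ is $z$ divided by the largest power of $2$ dividing it. $T_n$ is the digraph with vertices $v_1,\ldots,v_{2^n}$ and an edge $v_i\to v_j$ iff $i\neq j$ and $\mathsf{odd}(j-i)\equiv 1\pmod 4$. For a digraph with vertex set $V$ and edges $E$, a vertex $v$ and $Y\subseteq V$: $\tau_Y(v)=(|E\cap(Y\times\{v\})|,|E\cap(\{v\}\times Y)|)$. The tally-sequence $\vec\tau(v)=(t^v_0,t^v_1,\ldots)$ is defined recursively for all vertices simultaneously: $t^v_0=\tau_V(v)$, and $t^v_{k+1}=\tau_{X^v_k}(v)$ where $X^v_k=\{u\in V:(t^u_0,\ldots,t^u_k)=(t^v_0,\ldots,t^v_k)\}$. -}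

module Defs where

open import Data.Bool using (Bool; true; false; _∧_; if_then_else_)
open import Data.Nat as ℕ using (ℕ; zero; suc; _^_; _/_; _%_)
open import Data.Integer as ℤ using (ℤ; +_; -[1+_]; _-_; _%ℕ_)
open import Data.Fin using (Fin; toℕ)
import Data.Fin.Properties as FinP
open import Data.List using (List; []; _∷_; map; allFin)
open import Data.Nat.ListAction using (sum)
import Data.List.Properties as ListP
open import Data.Product using (_×_; _,_)
import Data.Product.Properties as ProdP
open import Relation.Nullary using (yes; no; ¬_)
open import Relation.Nullary.Decidable using (⌊_⌋)
open import Relation.Binary.PropositionalEquality using (_≡_)

-- Repeatedly halve while the number is nonzero and even.  The fuel
-- argument f bounds the number of halvings; fuel m suffices for m.
halveAll : ℕ → ℕ → ℕ
halveAll zero    m       = m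
halveAll (suc f) zero    = zero
halveAll (suc f) (suc m) with (suc m) % 2 ℕ.≟ 0
... | yes _ = halveAll f (suc m / 2)
... | no  _ = suc m

-- odd part of a natural number (oddℕ 0 = 0, irrelevant here)
oddℕ : ℕ → ℕ
oddℕ m = halveAll m m

-- odd(z) = z divided by the largest power of 2 dividing it (z ≠ 0)
oddℤ : ℤ → ℤ
oddℤ (+ m)      = + oddℕ m
oddℤ -[1+ m ]   = ℤ.- (+ oddℕ (suc m))

Digraph : ℕ → Set
Digraph N = Fin N → Fin N → Bool

-- The tournament T_n on vertices v_1..v_{2^n} (indexed here by Fin (2^n),
-- i.e. v_{i+1} ↦ i; differences j - i are unchanged):
-- v_i → v_j  iff  i ≠ j and odd(j - i) ≡ 1 (mod 4).
Tourn : (n : ℕ) → Digraph (2 ^ n)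
Tourn n i j = (if ⌊ i FinP.≟ j ⌋ then false else true)
        ∧ ⌊ (oddℤ ((+ toℕ j) - (+ toℕ i)) %ℕ 4) ℕ.≟ 1 ⌋

count : {N : ℕ} → (Fin N → Bool) → ℕ
count {N} P = sum (map (λ u → if P u then 1 else 0) (allFin N))

τ : {N : ℕ} → Digraph N → (Fin N → Bool) → Fin N → ℕ × ℕ
τ E Y v = count (λ u → Y u ∧ E u v) , count (λ u → Y u ∧ E v u)

_≟ₚ_ : (x y : ℕ × ℕ) → Relation.Nullary.Dec (x ≡ y)
_≟ₚ_ = ProdP.≡-dec ℕ._≟_ ℕ._≟_

_≟ₗ_ : (x y : List (ℕ × ℕ)) → Relation.Nullary.Dec (x ≡ y)
_≟ₗ_ = ListP.≡-dec _≟ₚ_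

mutual
  -- tallyPrefix E k v = (t^v_k , ... , t^v_1 , t^v_0)   (reversed prefix)
  tallyPrefix : {N : ℕ} → Digraph N → ℕ → Fin N → List (ℕ × ℕ)
  tallyPrefix E zero    v = τ E (λ _ → true) v ∷ []
  tallyPrefix E (suc k) v = τ E (X E k v) v ∷ tallyPrefix E k v

  X : {N : ℕ} → Digraph N → ℕ → Fin N → Fin N → Bool
  X E k v u = ⌊ tallyPrefix E k u ≟ₗ tallyPrefix E k v ⌋

tally : {N : ℕ} → Digraph N → Fin N → ℕ → ℕ × ℕ
tally E v zero    = τ E (λ _ → true) v
tally E v (suc k) = τ E (X E k v) v

module Submission where

-- Number the vertices 0, …, 2^n − 1. Inside an aligned block of 2^(j+1) vertices, a vertex r has
-- in-degree 2^j − 1 + b and out-degree 2^j − b, where b is the binary digit of r of weight 2^j: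
-- halving all differences preserves odd parts, so the vertices of r's parity behave like the
-- block of r/2 one level down, while the others differ from r by odd numbers alternating between
-- 1 and 3 modulo 4, and exactly half of them are arcs. By induction on k, the class X_k of a vertex
-- is therefore its aligned block of 2^(n−k−1) vertices, so the tallies t_0, t_1, … reveal the
-- binary digits of the vertex from the top, and after n steps the vertex is determined.

open import Defs
open import Data.Bool using (Bool; true; false; _∧_; if_then_else_)
open import Data.Empty using (⊥-elim)
open import Data.Fin as Fin using (Fin; toℕ)
import Data.Fin.Properties as Finₚ
open import Data.Integer as ℤ using (ℤ; +_; -[1+_]; _-_; _%ℕ_)
open import Data.Integer.DivMod using (a≡a%ℕn+[a/ℕn]*n; n%ℕd<d)
import Data.Integer.Properties as ℤₚ
open import Data.Integer.Tactic.RingSolver using (solve-∀)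
open import Data.List using ([]; _∷_; tabulate)
import Data.List.Properties as Listₚ
open import Data.Nat as ℕ using (ℕ; zero; suc; _+_; _*_; _∸_; _^_; _<_; _≤_; z≤n; s≤s)
open import Data.Nat.DivMod
open import Data.Nat.ListAction using (sum)
import Data.Nat.Properties as ℕₚ
import Data.Nat.Tactic.RingSolver as ℕ-Solver
open import Data.Product using (_×_; _,_; proj₁)
open import Data.Product.Function.NonDependent.Propositional using (_×-⇔_)
open import Data.Sum using (_⊎_; inj₁; inj₂)
open import Function using (_∘_; _⇔_; mk⇔; Equivalence)
import Function.Properties.Equivalence as ⇔
open import Relation.Binary.PropositionalEquality
open import Relation.Nullary using (¬_; Dec; yes; no)
open import Relation.Nullary.Decidable using (⌊_⌋; does-⇔; isYes≗does)

halveAll-even : ∀ f m → suc m % 2 ≡ 0 → halveAll (suc f) (suc m) ≡ halveAll f (suc m / 2)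
halveAll-even f m even with suc m % 2 ℕ.≟ 0
... | yes _  = refl
... | no odd = ⊥-elim (odd even)

halveAll-odd : ∀ f m → suc m % 2 ≢ 0 → halveAll (suc f) (suc m) ≡ suc m
halveAll-odd f m odd with suc m % 2 ℕ.≟ 0
... | yes even = ⊥-elim (odd even)
... | no _     = refl

halveAll-fuel : ∀ f g m → m ≤ f → m ≤ g → halveAll f m ≡ halveAll g m
halveAll-fuel zero    zero    m       _         _         = refl
halveAll-fuel zero    (suc g) zero    _         _         = refl
halveAll-fuel (suc f) zero    zero    _         _         = refl
halveAll-fuel (suc f) (suc g) zero    _         _         = refl
halveAll-fuel (suc f) (suc g) (suc m) (s≤s m≤f) (s≤s m≤g) with suc m % 2 ℕ.≟ 0
... | yes _ = halveAll-fuel f g (suc m / 2) (ℕₚ.≤-trans half≤m m≤f) (ℕₚ.≤-trans half≤m m≤g)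
  where
  half≤m : suc m / 2 ≤ m
  half≤m = ℕₚ.≤-pred (m/n<m (suc m) 2 (s≤s (s≤s z≤n)))
... | no _  = refl

m+m≡m*2 : ∀ m → m + m ≡ m * 2
m+m≡m*2 = ℕ-Solver.solve-∀

oddℕ-double : ∀ m → oddℕ (m + m) ≡ oddℕ m
oddℕ-double zero    = refl
oddℕ-double (suc k) = begin
  halveAll (suc (k + suc k)) (suc (k + suc k)) ≡⟨ halveAll-even (k + suc k) (k + suc k) even ⟩
  halveAll (k + suc k) ((m + m) / 2)           ≡⟨ cong (halveAll (k + suc k)) half ⟩
  halveAll (k + suc k) m                       ≡⟨ halveAll-fuel (k + suc k) m m (ℕₚ.m≤n+m m k) ℕₚ.≤-refl ⟩
  halveAll m m                                 ∎
  where
  open ≡-Reasoning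
  m = suc k
  even : (m + m) % 2 ≡ 0
  even = trans (cong (_% 2) (m+m≡m*2 m)) ([m+kn]%n≡m%n 0 m 2)
  half : (m + m) / 2 ≡ m
  half = trans (cong (_/ 2) (m+m≡m*2 m)) (m*n/n≡m m 2)

oddℕ-odd : ∀ m → oddℕ (suc (m + m)) ≡ suc (m + m)
oddℕ-odd m = halveAll-odd (m + m) (m + m) odd
  where
  odd : suc (m + m) % 2 ≢ 0
  odd even with trans (sym (trans (cong (λ x → suc x % 2) (m+m≡m*2 m)) ([m+kn]%n≡m%n 1 m 2))) even
  ... | ()

oddℤ-double : ∀ z → oddℤ (z ℤ.+ z) ≡ oddℤ z
oddℤ-double (+ m)    = cong +_ (oddℕ-double m)
oddℤ-double -[1+ m ] = cong (λ x → ℤ.- (+ x))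
  (trans (cong (λ x → oddℕ (suc x)) (sym (ℕₚ.+-suc m m))) (oddℕ-double (suc m)))

oddNumber : ℤ → ℤ
oddNumber y = + 1 ℤ.+ (y ℤ.+ y)

oddℤ-oddNumber : ∀ y → oddℤ (oddNumber y) ≡ oddNumber y
oddℤ-oddNumber (+ m)    = cong +_ (oddℕ-odd m)
oddℤ-oddNumber -[1+ m ] = cong (λ x → ℤ.- (+ x)) (oddℕ-odd m)

-- How _%ℕ_ computes `-[1+ m ] %ℕ 4` from `suc m % 4`.
negResidue : ℕ → ℕ
negResidue zero    = 0
negResidue (suc r) = 4 ∸ suc r

-[1+m]%ℕ4≡negResidue : ∀ m → -[1+ m ] %ℕ 4 ≡ negResidue (suc m % 4)
-[1+m]%ℕ4≡negResidue m with suc m % 4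
... | zero  = refl
... | suc r = refl

[a+4]%ℕ4≡a%ℕ4 : ∀ a → (a ℤ.+ + 4) %ℕ 4 ≡ a %ℕ 4
[a+4]%ℕ4≡a%ℕ4 (+ m)      = [m+n]%n≡m%n m 4
[a+4]%ℕ4≡a%ℕ4 -[1+ 0 ]   = refl
[a+4]%ℕ4≡a%ℕ4 -[1+ 1 ]   = refl
[a+4]%ℕ4≡a%ℕ4 -[1+ 2 ]   = refl
[a+4]%ℕ4≡a%ℕ4 -[1+ 3 ]   = refl
[a+4]%ℕ4≡a%ℕ4 -[1+ suc (suc (suc (suc k))) ] = begin
  -[1+ k ] %ℕ 4                ≡⟨ -[1+m]%ℕ4≡negResidue k ⟩
  negResidue (suc k % 4)       ≡⟨ cong negResidue (sym 4+k%4≡k%4) ⟩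
  negResidue ((4 + suc k) % 4) ≡⟨ sym (-[1+m]%ℕ4≡negResidue (4 + k)) ⟩
  -[1+ 4 + k ] %ℕ 4            ∎
  where
  open ≡-Reasoning
  4+k%4≡k%4 : (4 + suc k) % 4 ≡ suc k % 4
  4+k%4≡k%4 = trans (cong (_% 4) (ℕₚ.+-comm 4 (suc k))) ([m+n]%n≡m%n (suc k) 4)

[a+4n]%ℕ4≡a%ℕ4 : ∀ a n → (a ℤ.+ + 4 ℤ.* + n) %ℕ 4 ≡ a %ℕ 4
[a+4n]%ℕ4≡a%ℕ4 a zero    = cong (_%ℕ 4) (ℤₚ.+-identityʳ a)
[a+4n]%ℕ4≡a%ℕ4 a (suc n) = begin
  (a ℤ.+ + 4 ℤ.* + suc n) %ℕ 4          ≡⟨ cong (_%ℕ 4) (regroup a (+ n)) ⟩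
  ((a ℤ.+ + 4 ℤ.* + n) ℤ.+ + 4) %ℕ 4    ≡⟨ [a+4]%ℕ4≡a%ℕ4 (a ℤ.+ + 4 ℤ.* + n) ⟩
  (a ℤ.+ + 4 ℤ.* + n) %ℕ 4              ≡⟨ [a+4n]%ℕ4≡a%ℕ4 a n ⟩
  a %ℕ 4                                ∎
  where
  open ≡-Reasoning
  regroup : ∀ a x → a ℤ.+ + 4 ℤ.* (+ 1 ℤ.+ x) ≡ (a ℤ.+ + 4 ℤ.* x) ℤ.+ + 4
  regroup = solve-∀

[a+4w]%ℕ4≡a%ℕ4 : ∀ a w → (a ℤ.+ + 4 ℤ.* w) %ℕ 4 ≡ a %ℕ 4
[a+4w]%ℕ4≡a%ℕ4 a (+ n)    = [a+4n]%ℕ4≡a%ℕ4 a n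
[a+4w]%ℕ4≡a%ℕ4 a -[1+ n ] = sym (trans (cong (_%ℕ 4) (regroup a (+ n))) ([a+4n]%ℕ4≡a%ℕ4 b (suc n)))
  where
  b = a ℤ.+ + 4 ℤ.* -[1+ n ]
  regroup : ∀ a x → a ≡ (a ℤ.+ + 4 ℤ.* (ℤ.- (+ 1 ℤ.+ x))) ℤ.+ + 4 ℤ.* (+ 1 ℤ.+ x)
  regroup = solve-∀

fromBool : Bool → ℕ
fromBool b = if b then 1 else 0

arc : ℤ → Bool
arc z = ⌊ oddℤ z %ℕ 4 ℕ.≟ 1 ⌋

arc-double : ∀ z → arc (z ℤ.+ z) ≡ arc z
arc-double z = cong (λ x → ⌊ x %ℕ 4 ℕ.≟ 1 ⌋) (oddℤ-double z)

arc-oddNumber-periodic : ∀ y t → arc (oddNumber (y ℤ.+ + 2 ℤ.* t)) ≡ arc (oddNumber y)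
arc-oddNumber-periodic y t = cong (λ x → ⌊ x ℕ.≟ 1 ⌋) (begin
  oddℤ (oddNumber (y ℤ.+ + 2 ℤ.* t)) %ℕ 4 ≡⟨ cong (_%ℕ 4) (oddℤ-oddNumber (y ℤ.+ + 2 ℤ.* t)) ⟩
  oddNumber (y ℤ.+ + 2 ℤ.* t) %ℕ 4        ≡⟨ cong (_%ℕ 4) (regroup y t) ⟩
  (oddNumber y ℤ.+ + 4 ℤ.* t) %ℕ 4        ≡⟨ [a+4w]%ℕ4≡a%ℕ4 (oddNumber y) t ⟩
  oddNumber y %ℕ 4                        ≡⟨ cong (_%ℕ 4) (sym (oddℤ-oddNumber y)) ⟩
  oddℤ (oddNumber y) %ℕ 4                 ∎)
  where
  open ≡-Reasoning
  regroup : ∀ y t → + 1 ℤ.+ ((y ℤ.+ + 2 ℤ.* t) ℤ.+ (y ℤ.+ + 2 ℤ.* t)) ≡ (+ 1 ℤ.+ (y ℤ.+ y)) ℤ.+ + 4 ℤ.* t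
  regroup = solve-∀

arc-oddNumber-alternates : ∀ y → fromBool (arc (oddNumber y)) + fromBool (arc (oddNumber (y ℤ.+ + 1))) ≡ 1
arc-oddNumber-alternates y = subst Alternates (sym y≡b+2t) (residues (y %ℕ 2) (n%ℕd<d y 2))
  where
  t = y ℤ./ℕ 2
  Alternates : ℤ → Set
  Alternates y = fromBool (arc (oddNumber y)) + fromBool (arc (oddNumber (y ℤ.+ + 1))) ≡ 1
  y≡b+2t : y ≡ + (y %ℕ 2) ℤ.+ + 2 ℤ.* t
  y≡b+2t = trans (a≡a%ℕn+[a/ℕn]*n y 2) (cong (λ z → + (y %ℕ 2) ℤ.+ z) (ℤₚ.*-comm t (+ 2)))
  regroup : ∀ b t → (b ℤ.+ + 2 ℤ.* t) ℤ.+ + 1 ≡ (b ℤ.+ + 1) ℤ.+ + 2 ℤ.* t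
  regroup = solve-∀
  residues : ∀ b → b < 2 → Alternates (+ b ℤ.+ + 2 ℤ.* t)
  residues b b<2 = begin
    fromBool (arc (oddNumber (+ b ℤ.+ + 2 ℤ.* t))) + fromBool (arc (oddNumber ((+ b ℤ.+ + 2 ℤ.* t) ℤ.+ + 1)))
      ≡⟨ cong₂ (λ p q → fromBool p + fromBool q)
           (arc-oddNumber-periodic (+ b) t)
           (trans (cong (arc ∘ oddNumber) (regroup (+ b) t)) (arc-oddNumber-periodic (+ b ℤ.+ + 1) t)) ⟩
    fromBool (arc (oddNumber (+ b))) + fromBool (arc (oddNumber (+ b ℤ.+ + 1)))
      ≡⟨ base b b<2 ⟩
    1 ∎
    where
    open ≡-Reasoning
    base : ∀ b → b < 2 → Alternates (+ b)
    base 0 _ = refl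
    base 1 _ = refl
    base (suc (suc _)) (s≤s (s≤s ()))

Tourn-arc : ∀ n (u v : Fin (2 ^ n)) → Tourn n u v ≡ arc (+ toℕ v - + toℕ u)
Tourn-arc n u v with u Finₚ.≟ v
... | yes refl = cong arc (sym (ℤₚ.+-inverseʳ (+ toℕ u)))
... | no _     = refl

countBelow : ℕ → (ℕ → Bool) → ℕ
countBelow zero    f = 0
countBelow (suc n) f = fromBool (f 0) + countBelow n (f ∘ suc)

countBelow-cong-< : ∀ N {f g} → (∀ x → x < N → f x ≡ g x) → countBelow N f ≡ countBelow N g
countBelow-cong-< zero    f≡g = refl
countBelow-cong-< (suc N) f≡g =
  cong₂ _+_ (cong fromBool (f≡g 0 (s≤s z≤n))) (countBelow-cong-< N (λ x x<N → f≡g (suc x) (s≤s x<N)))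

countBelow-cong : ∀ N {f g} → (∀ x → f x ≡ g x) → countBelow N f ≡ countBelow N g
countBelow-cong N f≡g = countBelow-cong-< N (λ x _ → f≡g x)

countBelow-const : ∀ N b → countBelow N (λ _ → b) ≡ N * fromBool b
countBelow-const zero    b = refl
countBelow-const (suc N) b = cong (_+_ (fromBool b)) (countBelow-const N b)

countBelow-false : ∀ N → countBelow N (λ _ → false) ≡ 0
countBelow-false N = trans (countBelow-const N false) (ℕₚ.*-zeroʳ N)

countBelow-+ : ∀ M N f → countBelow (M + N) f ≡ countBelow M f + countBelow N (λ x → f (M + x))
countBelow-+ zero    N f = refl
countBelow-+ (suc M) N f =
  trans (cong (_+_ (fromBool (f 0))) (countBelow-+ M N (f ∘ suc))) (sym (ℕₚ.+-assoc (fromBool (f 0)) _ _))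

countBelow-parity : ∀ N f →
  countBelow (N + N) f ≡ countBelow N (λ x → f (x + x)) + countBelow N (λ x → f (suc (x + x)))
countBelow-parity zero    f = refl
countBelow-parity (suc N) f = begin
  countBelow (suc N + suc N) f
    ≡⟨ cong (λ M → countBelow (suc M) f) (ℕₚ.+-suc N N) ⟩
  f₀ + (f₁ + countBelow (N + N) (f ∘ suc ∘ suc))
    ≡⟨ cong (λ z → f₀ + (f₁ + z)) (countBelow-parity N (f ∘ suc ∘ suc)) ⟩
  f₀ + (f₁ + (evens + odds))
    ≡⟨ interchange f₀ f₁ evens odds ⟩
  (f₀ + evens) + (f₁ + odds)
    ≡⟨ cong₂ (λ e o → (f₀ + e) + (f₁ + o))
         (countBelow-cong N (λ x → cong (f ∘ suc) (sym (ℕₚ.+-suc x x))))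
         (countBelow-cong N (λ x → cong (f ∘ suc ∘ suc) (sym (ℕₚ.+-suc x x)))) ⟩
  countBelow (suc N) (λ x → f (x + x)) + countBelow (suc N) (λ x → f (suc (x + x))) ∎
  where
  open ≡-Reasoning
  f₀ = fromBool (f 0)
  f₁ = fromBool (f 1)
  evens = countBelow N (λ x → f (suc (suc (x + x))))
  odds  = countBelow N (λ x → f (suc (suc (suc (x + x)))))
  interchange : ∀ a b c d → a + (b + (c + d)) ≡ (a + c) + (b + d)
  interchange = ℕ-Solver.solve-∀

count≡countBelow : ∀ N (P : Fin N → Bool) (g : ℕ → Bool) → (∀ u → P u ≡ g (toℕ u)) → count P ≡ countBelow N g
count≡countBelow N P g P≡g =
  trans (cong sum (Listₚ.map-tabulate (λ u → u) (λ u → if P u then 1 else 0))) (sumTabulate N P g P≡g)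
  where
  sumTabulate : ∀ N (P : Fin N → Bool) (g : ℕ → Bool) → (∀ u → P u ≡ g (toℕ u)) →
    sum (tabulate (λ u → if P u then 1 else 0)) ≡ countBelow N g
  sumTabulate zero    P g P≡g = refl
  sumTabulate (suc N) P g P≡g =
    cong₂ _+_ (cong fromBool (P≡g Fin.zero)) (sumTabulate N (P ∘ Fin.suc) (g ∘ suc) (P≡g ∘ Fin.suc))

⌊⌋-⇔ : ∀ {A B : Set} → A ⇔ B → (a? : Dec A) (b? : Dec B) → ⌊ a? ⌋ ≡ ⌊ b? ⌋
⌊⌋-⇔ A⇔B a? b? = trans (isYes≗does a?) (trans (does-⇔ A⇔B a? b?) (sym (isYes≗does b?)))

countBelow-block : ∀ m L .{{_ : ℕ.NonZero L}} c (h : ℕ → Bool) → c < m →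
  countBelow (m * L) (λ x → ⌊ x / L ℕ.≟ c ⌋ ∧ h x) ≡ countBelow L (λ s → h (c * L + s))
countBelow-block (suc m) L c h c≤m = begin
  countBelow (L + m * L) F
    ≡⟨ countBelow-+ L (m * L) F ⟩
  countBelow L F + countBelow (m * L) (λ x → F (L + x))
    ≡⟨ cong₂ _+_ (countBelow-cong-< L (λ x x<L → cong (λ q → ⌊ q ℕ.≟ c ⌋ ∧ h x) (m<n⇒m/n≡0 x<L)))
                 (countBelow-cong (m * L) (λ x → cong (λ q → ⌊ q ℕ.≟ c ⌋ ∧ h (L + x)) (L+x/L≡1+x/L x))) ⟩
  countBelow L (λ x → ⌊ 0 ℕ.≟ c ⌋ ∧ h x) + countBelow (m * L) (λ x → ⌊ suc (x / L) ℕ.≟ c ⌋ ∧ h (L + x))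
    ≡⟨ byBlock c c≤m ⟩
  countBelow L (λ s → h (c * L + s)) ∎
  where
  open ≡-Reasoning
  F : ℕ → Bool
  F x = ⌊ x / L ℕ.≟ c ⌋ ∧ h x
  L+x/L≡1+x/L : ∀ x → (L + x) / L ≡ suc (x / L)
  L+x/L≡1+x/L x = trans (m/n≡1+[m∸n]/n (ℕₚ.m≤m+n L x)) (cong (λ y → suc (y / L)) (ℕₚ.m+n∸m≡n L x))
  byBlock : ∀ c → c < suc m →
    countBelow L (λ x → ⌊ 0 ℕ.≟ c ⌋ ∧ h x) + countBelow (m * L) (λ x → ⌊ suc (x / L) ℕ.≟ c ⌋ ∧ h (L + x))
      ≡ countBelow L (λ s → h (c * L + s))
  byBlock zero    _ = trans (cong (_+_ (countBelow L h)) (countBelow-false (m * L))) (ℕₚ.+-identityʳ _)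
  byBlock (suc c) (s≤s c<m) = begin
    countBelow L (λ _ → false) + countBelow (m * L) (λ x → ⌊ suc (x / L) ℕ.≟ suc c ⌋ ∧ h (L + x))
      ≡⟨ cong₂ _+_ (countBelow-false L)
           (countBelow-cong (m * L) (λ x → cong (_∧ h (L + x)) (⌊⌋-⇔ (mk⇔ ℕₚ.suc-injective (cong suc)) (suc (x / L) ℕ.≟ suc c) (x / L ℕ.≟ c)))) ⟩
    countBelow (m * L) (λ x → ⌊ x / L ℕ.≟ c ⌋ ∧ h (L + x))
      ≡⟨ countBelow-block m L c (λ x → h (L + x)) c<m ⟩
    countBelow L (λ s → h (L + (c * L + s)))
      ≡⟨ countBelow-cong L (λ s → cong h (sym (ℕₚ.+-assoc L (c * L) s))) ⟩
    countBelow L (λ s → h (suc c * L + s)) ∎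

countBelow-alternating : ∀ N y ε → ε ≡ + 1 ⊎ ε ≡ ℤ.-1ℤ →
  countBelow (N + N) (λ x → arc (oddNumber (y ℤ.+ ε ℤ.* + x))) ≡ N
countBelow-alternating N y ε ε≡±1 = begin
  countBelow (N + N) F
    ≡⟨ countBelow-parity N F ⟩
  countBelow N (λ x → F (x + x)) + countBelow N (λ x → F (suc (x + x)))
    ≡⟨ cong₂ _+_
         (countBelow-cong N (λ x → trans (cong (arc ∘ oddNumber) (even y ε (+ x)))
                                         (arc-oddNumber-periodic y (ε ℤ.* + x))))
         (countBelow-cong N (λ x → trans (cong (arc ∘ oddNumber) (odd y ε (+ x)))
                                         (arc-oddNumber-periodic (y ℤ.+ ε) (ε ℤ.* + x)))) ⟩
  countBelow N (λ _ → arc (oddNumber y)) + countBelow N (λ _ → arc (oddNumber (y ℤ.+ ε)))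
    ≡⟨ cong₂ _+_ (countBelow-const N _) (countBelow-const N _) ⟩
  N * fromBool (arc (oddNumber y)) + N * fromBool (arc (oddNumber (y ℤ.+ ε)))
    ≡⟨ sym (ℕₚ.*-distribˡ-+ N _ _) ⟩
  N * (fromBool (arc (oddNumber y)) + fromBool (arc (oddNumber (y ℤ.+ ε))))
    ≡⟨ cong (N *_) (alternates ε≡±1) ⟩
  N * 1
    ≡⟨ ℕₚ.*-identityʳ N ⟩
  N ∎
  where
  open ≡-Reasoning
  F : ℕ → Bool
  F x = arc (oddNumber (y ℤ.+ ε ℤ.* + x))
  even : ∀ y ε x → y ℤ.+ ε ℤ.* (x ℤ.+ x) ≡ y ℤ.+ + 2 ℤ.* (ε ℤ.* x)
  even = solve-∀
  odd : ∀ y ε x → y ℤ.+ ε ℤ.* (+ 1 ℤ.+ (x ℤ.+ x)) ≡ (y ℤ.+ ε) ℤ.+ + 2 ℤ.* (ε ℤ.* x)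
  odd = solve-∀
  alternates : ε ≡ + 1 ⊎ ε ≡ ℤ.-1ℤ →
    fromBool (arc (oddNumber y)) + fromBool (arc (oddNumber (y ℤ.+ ε))) ≡ 1
  alternates (inj₁ refl) = arc-oddNumber-alternates y
  alternates (inj₂ refl) = begin
    weight y + weight (y - + 1)                   ≡⟨ ℕₚ.+-comm (weight y) (weight (y - + 1)) ⟩
    weight (y - + 1) + weight y                   ≡⟨ cong (λ z → weight (y - + 1) + weight z) (cancel y) ⟩
    weight (y - + 1) + weight ((y - + 1) ℤ.+ + 1) ≡⟨ arc-oddNumber-alternates (y - + 1) ⟩
    1                                             ∎
    where
    weight : ℤ → ℕ
    weight z = fromBool (arc (oddNumber z))
    cancel : ∀ y → y ≡ (y - + 1) ℤ.+ + 1
    cancel = solve-∀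

data Direction : Set where
  incoming outgoing : Direction

-- s → r is an arc iff arc (offset incoming r s), and r → s iff arc (offset outgoing r s).
offset : Direction → ℕ → ℕ → ℤ
offset incoming r s = + r - + s
offset outgoing r s = + s - + r

blockDegree : Direction → ℕ → ℕ → ℕ
blockDegree d j r = countBelow (2 ^ suc j) (λ s → arc (offset d r s))

2^[1+j]≡2^j+2^j : ∀ j → 2 ^ suc j ≡ 2 ^ j + 2 ^ j
2^[1+j]≡2^j+2^j j = cong (_+_ (2 ^ j)) (ℕₚ.+-identityʳ (2 ^ j))

arc-offset-sameParity : ∀ d e r s → arc (offset d (e + (r + r)) (e + (s + s))) ≡ arc (offset d r s)
arc-offset-sameParity incoming e r s = trans (cong arc (halve (+ e) (+ r) (+ s))) (arc-double (+ r - + s))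
  where
  halve : ∀ e a b → (e ℤ.+ (a ℤ.+ a)) - (e ℤ.+ (b ℤ.+ b)) ≡ (a - b) ℤ.+ (a - b)
  halve = solve-∀
arc-offset-sameParity outgoing e r s = trans (cong arc (halve (+ e) (+ r) (+ s))) (arc-double (+ s - + r))
  where
  halve : ∀ e a b → (e ℤ.+ (b ℤ.+ b)) - (e ℤ.+ (a ℤ.+ a)) ≡ (b - a) ℤ.+ (b - a)
  halve = solve-∀

-- The differences to the opposite-parity half of the block are odd and alternate between 1 and 3 modulo 4.
countBelow-arc-oppositeParity : ∀ d j e r → e < 2 →
  countBelow (2 ^ suc j) (λ x → arc (offset d (e + (r + r)) ((1 ∸ e) + (x + x)))) ≡ 2 ^ j
countBelow-arc-oppositeParity d j e r e<2 =
  trans (cong (λ M → countBelow M F) (2^[1+j]≡2^j+2^j j))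
        (trans (countBelow-cong (2 ^ j + 2 ^ j) (λ x → cong arc (asOddNumber d e e<2 r x)))
               (countBelow-alternating (2 ^ j) (start d e (+ r)) (step d) (step≡±1 d)))
  where
  F : ℕ → Bool
  F x = arc (offset d (e + (r + r)) ((1 ∸ e) + (x + x)))
  step : Direction → ℤ
  step incoming = ℤ.-1ℤ
  step outgoing = + 1
  step≡±1 : ∀ d → step d ≡ + 1 ⊎ step d ≡ ℤ.-1ℤ
  step≡±1 incoming = inj₂ refl
  step≡±1 outgoing = inj₁ refl
  start : Direction → ℕ → ℤ → ℤ
  start incoming e r = r - + (1 ∸ e)
  start outgoing e r = ℤ.- r - + e
  asOddNumber : ∀ d e → e < 2 → ∀ r x →
    offset d (e + (r + r)) ((1 ∸ e) + (x + x)) ≡ oddNumber (start d e (+ r) ℤ.+ step d ℤ.* + x)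
  asOddNumber incoming 0 _ r x = ring (+ r) (+ x)
    where
    ring : ∀ r x → (r ℤ.+ r) - (+ 1 ℤ.+ (x ℤ.+ x))
                 ≡ + 1 ℤ.+ (((r - + 1) ℤ.+ ℤ.-1ℤ ℤ.* x) ℤ.+ ((r - + 1) ℤ.+ ℤ.-1ℤ ℤ.* x))
    ring = solve-∀
  asOddNumber incoming 1 _ r x = ring (+ r) (+ x)
    where
    ring : ∀ r x → (+ 1 ℤ.+ (r ℤ.+ r)) - (x ℤ.+ x)
                 ≡ + 1 ℤ.+ (((r - + 0) ℤ.+ ℤ.-1ℤ ℤ.* x) ℤ.+ ((r - + 0) ℤ.+ ℤ.-1ℤ ℤ.* x))
    ring = solve-∀
  asOddNumber outgoing 0 _ r x = ring (+ r) (+ x)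
    where
    ring : ∀ r x → (+ 1 ℤ.+ (x ℤ.+ x)) - (r ℤ.+ r)
                 ≡ + 1 ℤ.+ (((ℤ.- r - + 0) ℤ.+ + 1 ℤ.* x) ℤ.+ ((ℤ.- r - + 0) ℤ.+ + 1 ℤ.* x))
    ring = solve-∀
  asOddNumber outgoing 1 _ r x = ring (+ r) (+ x)
    where
    ring : ∀ r x → (x ℤ.+ x) - (+ 1 ℤ.+ (r ℤ.+ r))
                 ≡ + 1 ℤ.+ (((ℤ.- r - + 1) ℤ.+ + 1 ℤ.* x) ℤ.+ ((ℤ.- r - + 1) ℤ.+ + 1 ℤ.* x))
    ring = solve-∀
  asOddNumber d (suc (suc _)) (s≤s (s≤s ())) r x

blockDegree-suc : ∀ d j r → blockDegree d (suc j) r ≡ blockDegree d j (r / 2) + 2 ^ j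
blockDegree-suc d j r = trans (cong (blockDegree d (suc j)) r≡r%2+[q+q]) (byDigit (r % 2) (m%n<n r 2))
  where
  q = r / 2
  M = 2 ^ suc j
  r≡r%2+[q+q] : r ≡ r % 2 + (q + q)
  r≡r%2+[q+q] = trans (m≡m%n+[m/n]*n r 2) (cong (_+_ (r % 2)) (sym (m+m≡m*2 q)))
  byParity : ∀ r → blockDegree d (suc j) r
    ≡ countBelow M (λ x → arc (offset d r (x + x))) + countBelow M (λ x → arc (offset d r (suc (x + x))))
  byParity r = trans (cong (λ N → countBelow N (λ s → arc (offset d r s))) (2^[1+j]≡2^j+2^j (suc j)))
                     (countBelow-parity M (λ s → arc (offset d r s)))
  byDigit : ∀ e → e < 2 → blockDegree d (suc j) (e + (q + q)) ≡ blockDegree d j q + 2 ^ j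
  byDigit 0 e<2 = trans (byParity (q + q))
    (cong₂ _+_ (countBelow-cong M (arc-offset-sameParity d 0 q)) (countBelow-arc-oppositeParity d j 0 q e<2))
  byDigit 1 e<2 = trans (byParity (1 + (q + q)))
    (trans (cong₂ _+_ (countBelow-arc-oppositeParity d j 1 q e<2) (countBelow-cong M (arc-offset-sameParity d 1 q)))
           (ℕₚ.+-comm (2 ^ j) (blockDegree d j q)))
  byDigit (suc (suc _)) (s≤s (s≤s ()))

infixl 7 _/2^_ _%2^_

_/2^_ : ℕ → ℕ → ℕ
x /2^ j = _/_ x (2 ^ j) {{ℕₚ.m^n≢0 2 j}}

_%2^_ : ℕ → ℕ → ℕ
x %2^ j = _%_ x (2 ^ j) {{ℕₚ.m^n≢0 2 j}}

/2^-suc : ∀ j x → x /2^ suc j ≡ (x / 2) /2^ j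
/2^-suc j x = sym (m/n/o≡m/[n*o] x 2 (2 ^ j) {{_}} {{ℕₚ.m^n≢0 2 j}} {{ℕₚ.m^n≢0 2 (suc j)}})

half<2^ : ∀ j r → r < 2 ^ suc j → r / 2 < 2 ^ j
half<2^ j r r< = m<n*o⇒m/o<n {r} {2 ^ j} {2} (subst (r <_) (ℕₚ.*-comm 2 (2 ^ j)) r<)

blockDegree-incoming : ∀ j r → r < 2 ^ suc j → blockDegree incoming j r + 1 ≡ 2 ^ j + r /2^ j
blockDegree-incoming zero    0             _               = refl
blockDegree-incoming zero    1             _               = refl
blockDegree-incoming zero    (suc (suc r)) (s≤s (s≤s ()))
blockDegree-incoming (suc j) r             r<              = begin
  blockDegree incoming (suc j) r + 1        ≡⟨ cong (_+ 1) (blockDegree-suc incoming j r) ⟩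
  blockDegree incoming j (r / 2) + 2 ^ j + 1 ≡⟨ regroup (blockDegree incoming j (r / 2)) (2 ^ j) ⟩
  (blockDegree incoming j (r / 2) + 1) + 2 ^ j
    ≡⟨ cong (_+ 2 ^ j) (blockDegree-incoming j (r / 2) (half<2^ (suc j) r r<)) ⟩
  (2 ^ j + (r / 2) /2^ j) + 2 ^ j            ≡⟨ regroup′ (2 ^ j) ((r / 2) /2^ j) ⟩
  2 ^ suc j + (r / 2) /2^ j                  ≡⟨ cong (_+_ (2 ^ suc j)) (sym (/2^-suc j r)) ⟩
  2 ^ suc j + r /2^ suc j                    ∎
  where
  open ≡-Reasoning
  regroup : ∀ a b → a + b + 1 ≡ (a + 1) + b
  regroup = ℕ-Solver.solve-∀
  regroup′ : ∀ a b → (a + b) + a ≡ (a + (a + 0)) + b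
  regroup′ = ℕ-Solver.solve-∀

blockDegree-outgoing : ∀ j r → r < 2 ^ suc j → blockDegree outgoing j r + r /2^ j ≡ 2 ^ j
blockDegree-outgoing zero    0             _               = refl
blockDegree-outgoing zero    1             _               = refl
blockDegree-outgoing zero    (suc (suc r)) (s≤s (s≤s ()))
blockDegree-outgoing (suc j) r             r<              = begin
  blockDegree outgoing (suc j) r + r /2^ suc j
    ≡⟨ cong₂ _+_ (blockDegree-suc outgoing j r) (/2^-suc j r) ⟩
  blockDegree outgoing j (r / 2) + 2 ^ j + (r / 2) /2^ j
    ≡⟨ regroup (blockDegree outgoing j (r / 2)) (2 ^ j) ((r / 2) /2^ j) ⟩
  (blockDegree outgoing j (r / 2) + (r / 2) /2^ j) + 2 ^ j
    ≡⟨ cong (_+ 2 ^ j) (blockDegree-outgoing j (r / 2) (half<2^ (suc j) r r<)) ⟩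
  2 ^ j + 2 ^ j
    ≡⟨ sym (2^[1+j]≡2^j+2^j j) ⟩
  2 ^ suc j ∎
  where
  open ≡-Reasoning
  regroup : ∀ a b c → a + b + c ≡ (a + c) + b
  regroup = ℕ-Solver.solve-∀

blockDegrees : ℕ → ℕ → ℕ × ℕ
blockDegrees j r = blockDegree incoming j r , blockDegree outgoing j r

blockDegrees≡⇔/2^≡ : ∀ j r r′ → r < 2 ^ suc j → r′ < 2 ^ suc j →
  blockDegrees j r ≡ blockDegrees j r′ ⇔ r /2^ j ≡ r′ /2^ j
blockDegrees≡⇔/2^≡ j r r′ r< r′< = mk⇔ digit≡ degrees≡
  where
  digit≡ : blockDegrees j r ≡ blockDegrees j r′ → r /2^ j ≡ r′ /2^ j
  digit≡ eq = ℕₚ.+-cancelˡ-≡ (2 ^ j) _ _ (begin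
    2 ^ j + r /2^ j                ≡⟨ sym (blockDegree-incoming j r r<) ⟩
    blockDegree incoming j r + 1   ≡⟨ cong (λ p → proj₁ p + 1) eq ⟩
    blockDegree incoming j r′ + 1  ≡⟨ blockDegree-incoming j r′ r′< ⟩
    2 ^ j + r′ /2^ j               ∎)
    where open ≡-Reasoning
  degrees≡ : r /2^ j ≡ r′ /2^ j → blockDegrees j r ≡ blockDegrees j r′
  degrees≡ eq = cong₂ _,_
    (ℕₚ.+-cancelʳ-≡ 1 _ _ (begin
      blockDegree incoming j r + 1   ≡⟨ blockDegree-incoming j r r< ⟩
      2 ^ j + r /2^ j                ≡⟨ cong (_+_ (2 ^ j)) eq ⟩
      2 ^ j + r′ /2^ j               ≡⟨ sym (blockDegree-incoming j r′ r′<) ⟩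
      blockDegree incoming j r′ + 1  ∎))
    (ℕₚ.+-cancelʳ-≡ (r′ /2^ j) _ _ (begin
      blockDegree outgoing j r + r′ /2^ j  ≡⟨ cong (_+_ (blockDegree outgoing j r)) (sym eq) ⟩
      blockDegree outgoing j r + r /2^ j   ≡⟨ blockDegree-outgoing j r r< ⟩
      2 ^ j                                ≡⟨ sym (blockDegree-outgoing j r′ r′<) ⟩
      blockDegree outgoing j r′ + r′ /2^ j ∎))
    where open ≡-Reasoning

tournArc : ∀ n → Direction → Fin (2 ^ n) → Fin (2 ^ n) → Bool
tournArc n incoming w u = Tourn n u w
tournArc n outgoing w u = Tourn n w u

tournArc≡arc-offset : ∀ n d (w u : Fin (2 ^ n)) → tournArc n d w u ≡ arc (offset d (toℕ w) (toℕ u))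
tournArc≡arc-offset n incoming w u = Tourn-arc n u w
tournArc≡arc-offset n outgoing w u = Tourn-arc n w u

offset-translate : ∀ d r s t → offset d (r + t) (t + s) ≡ offset d r s
offset-translate incoming r s t = ring (+ r) (+ s) (+ t)
  where
  ring : ∀ r s t → (r ℤ.+ t) - (t ℤ.+ s) ≡ r - s
  ring = solve-∀
offset-translate outgoing r s t = ring (+ r) (+ s) (+ t)
  where
  ring : ∀ r s t → (t ℤ.+ s) - (r ℤ.+ t) ≡ s - r
  ring = solve-∀

count-tournArc-block : ∀ n j m d (w : Fin (2 ^ n)) → 2 ^ n ≡ m * 2 ^ suc j → (Y : Fin (2 ^ n) → Bool) →
  (∀ u → Y u ≡ ⌊ toℕ u /2^ suc j ℕ.≟ toℕ w /2^ suc j ⌋) →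
  count (λ u → Y u ∧ tournArc n d w u) ≡ blockDegree d j (toℕ w %2^ suc j)
count-tournArc-block n j m d w 2^n≡m*L Y Y≡block = begin
  count (λ u → Y u ∧ tournArc n d w u)
    ≡⟨ count≡countBelow (2 ^ n) _ F (λ u → cong₂ _∧_ (Y≡block u) (tournArc≡arc-offset n d w u)) ⟩
  countBelow (2 ^ n) F
    ≡⟨ cong (λ N → countBelow N F) 2^n≡m*L ⟩
  countBelow (m * L) F
    ≡⟨ countBelow-block m L {{ℕₚ.m^n≢0 2 (suc j)}} c (λ x → arc (offset d w′ x)) c<m ⟩
  countBelow L (λ s → arc (offset d w′ (c * L + s)))
    ≡⟨ countBelow-cong L (λ s → cong arc (trans (cong (λ z → offset d z (c * L + s)) w′≡r+cL)
                                              (offset-translate d r s (c * L)))) ⟩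
  blockDegree d j r ∎
  where
  open ≡-Reasoning
  L = 2 ^ suc j
  w′ = toℕ w
  c = w′ /2^ suc j
  r = w′ %2^ suc j
  F : ℕ → Bool
  F x = ⌊ x /2^ suc j ℕ.≟ c ⌋ ∧ arc (offset d w′ x)
  c<m : c < m
  c<m = m<n*o⇒m/o<n {{ℕₚ.m^n≢0 2 (suc j)}} (subst (w′ <_) 2^n≡m*L (Finₚ.toℕ<n w))
  w′≡r+cL : w′ ≡ r + c * L
  w′≡r+cL = m≡m%n+[m/n]*n w′ L {{ℕₚ.m^n≢0 2 (suc j)}}

τ-Tourn-block : ∀ n j m (w : Fin (2 ^ n)) → 2 ^ n ≡ m * 2 ^ suc j → (Y : Fin (2 ^ n) → Bool) →
  (∀ u → Y u ≡ ⌊ toℕ u /2^ suc j ℕ.≟ toℕ w /2^ suc j ⌋) →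
  τ (Tourn n) Y w ≡ blockDegrees j (toℕ w %2^ suc j)
τ-Tourn-block n j m w 2^n≡m*L Y Y≡block = cong₂ _,_
  (count-tournArc-block n j m incoming w 2^n≡m*L Y Y≡block)
  (count-tournArc-block n j m outgoing w 2^n≡m*L Y Y≡block)

/2^≡⇔digit≡×/2^[1+j]≡ : ∀ j x y →
  x /2^ j ≡ y /2^ j ⇔ (((x %2^ suc j) /2^ j ≡ (y %2^ suc j) /2^ j) × (x /2^ suc j ≡ y /2^ suc j))
/2^≡⇔digit≡×/2^[1+j]≡ j x y = mk⇔
  (λ eq → along via-digit (cong (_% 2) eq) , along via-/2 (cong (_/ 2) eq))
  (λ { (digit≡ , high≡) → begin
    x /2^ j                           ≡⟨ m≡m%n+[m/n]*n (x /2^ j) 2 ⟩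
    (x /2^ j) % 2 + (x /2^ j) / 2 * 2 ≡⟨ cong₂ (λ a b → a + b * 2) (along (sym ∘ via-digit) digit≡)
                                                                 (along (sym ∘ via-/2) high≡) ⟩
    (y /2^ j) % 2 + (y /2^ j) / 2 * 2 ≡⟨ sym (m≡m%n+[m/n]*n (y /2^ j) 2) ⟩
    y /2^ j                           ∎ })
  where
  open ≡-Reasoning
  along : ∀ {f g : ℕ → ℕ} → (∀ z → f z ≡ g z) → g x ≡ g y → f x ≡ f y
  along f≡g eq = trans (f≡g x) (trans eq (sym (f≡g y)))
  via-digit : ∀ z → (z %2^ suc j) /2^ j ≡ (z /2^ j) % 2
  via-digit z = m%[n*o]/o≡m/o%n z 2 (2 ^ j) {{_}} {{ℕₚ.m^n≢0 2 j}} {{ℕₚ.m^n≢0 2 (suc j)}}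
  via-/2 : ∀ z → z /2^ suc j ≡ (z /2^ j) / 2
  via-/2 z = sym (trans (m/n/o≡m/[n*o] z (2 ^ j) 2 {{ℕₚ.m^n≢0 2 j}} {{_}} {{2^j*2≢0}})
                        (/-congʳ {{2^j*2≢0}} {{ℕₚ.m^n≢0 2 (suc j)}} (ℕₚ.*-comm (2 ^ j) 2)))
    where
    2^j*2≢0 = ℕₚ.m*n≢0 (2 ^ j) 2 {{ℕₚ.m^n≢0 2 j}}

≡⇔≡ : ∀ {A : Set} {a a′ b b′ : A} → a ≡ a′ → b ≡ b′ → (a ≡ b) ⇔ (a′ ≡ b′)
≡⇔≡ refl refl = ⇔.refl

tallyPrefix≡⇔/2^≡ : ∀ n k j → k + suc j ≡ n → (w v : Fin (2 ^ n)) →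
  tallyPrefix (Tourn n) k w ≡ tallyPrefix (Tourn n) k v ⇔ toℕ w /2^ j ≡ toℕ v /2^ j
tallyPrefix≡⇔/2^≡ .(suc j) zero j refl w v =
  ⇔.trans (mk⇔ Listₚ.∷-injectiveˡ (cong (_∷ [])))
    (⇔.trans (≡⇔≡ (tally₀ w) (tally₀ v))
      (blockDegrees≡⇔/2^≡ j (toℕ w) (toℕ v) (Finₚ.toℕ<n w) (Finₚ.toℕ<n v)))
  where
  n = suc j
  tally₀ : ∀ (w : Fin (2 ^ n)) → τ (Tourn n) (λ _ → true) w ≡ blockDegrees j (toℕ w)
  tally₀ w = trans
    (τ-Tourn-block n j 1 w (sym (ℕₚ.*-identityˡ (2 ^ n))) (λ _ → true)
      (λ u → sym (cong₂ (λ a b → ⌊ a ℕ.≟ b ⌋) (m<n⇒m/n≡0 {{ℕₚ.m^n≢0 2 n}} (Finₚ.toℕ<n u))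
                                                 (m<n⇒m/n≡0 {{ℕₚ.m^n≢0 2 n}} (Finₚ.toℕ<n w)))))
    (cong (blockDegrees j) (m<n⇒m%n≡m {{ℕₚ.m^n≢0 2 n}} (Finₚ.toℕ<n w)))
tallyPrefix≡⇔/2^≡ n (suc k) j k+1+j≡n w v =
  ⇔.trans (mk⇔ Listₚ.∷-injective (λ { (h , t) → cong₂ _∷_ h t }))
    (⇔.trans (≡⇔≡ (tallyₖ w) (tallyₖ v)
               ×-⇔ previous w v)
      (⇔.trans (blockDegrees≡⇔/2^≡ j (toℕ w %2^ suc j) (toℕ v %2^ suc j) (rem< w) (rem< v)
                 ×-⇔ ⇔.refl)
        (⇔.sym (/2^≡⇔digit≡×/2^[1+j]≡ j (toℕ w) (toℕ v)))))
  where
  previous : ∀ w v → tallyPrefix (Tourn n) k w ≡ tallyPrefix (Tourn n) k v ⇔ toℕ w /2^ suc j ≡ toℕ v /2^ suc j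
  previous = tallyPrefix≡⇔/2^≡ n k (suc j) (trans (ℕₚ.+-suc k (suc j)) k+1+j≡n)
  X≡block : ∀ w u → X (Tourn n) k w u ≡ ⌊ toℕ u /2^ suc j ℕ.≟ toℕ w /2^ suc j ⌋
  X≡block w u = ⌊⌋-⇔ (previous u w) (tallyPrefix (Tourn n) k u ≟ₗ tallyPrefix (Tourn n) k w)
                                    (toℕ u /2^ suc j ℕ.≟ toℕ w /2^ suc j)
  2^n≡2^[1+k]*2^[1+j] : 2 ^ n ≡ 2 ^ suc k * 2 ^ suc j
  2^n≡2^[1+k]*2^[1+j] = trans (cong (2 ^_) (sym k+1+j≡n)) (ℕₚ.^-distribˡ-+-* 2 (suc k) (suc j))
  tallyₖ : ∀ w → τ (Tourn n) (X (Tourn n) k w) w ≡ blockDegrees j (toℕ w %2^ suc j)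
  tallyₖ w = τ-Tourn-block n j (2 ^ suc k) w 2^n≡2^[1+k]*2^[1+j] (X (Tourn n) k w) (X≡block w)
  rem< : ∀ w → toℕ w %2^ suc j < 2 ^ suc j
  rem< w = m%n<n (toℕ w) (2 ^ suc j) {{ℕₚ.m^n≢0 2 (suc j)}}

tallyPrefix-cong : ∀ {N} (E : Digraph N) {u v} → (∀ k → tally E u k ≡ tally E v k) →
  ∀ k → tallyPrefix E k u ≡ tallyPrefix E k v
tallyPrefix-cong E same zero    = cong (_∷ []) (same zero)
tallyPrefix-cong E same (suc k) = cong₂ _∷_ (same (suc k)) (tallyPrefix-cong E same k)

lemma7p5 : (n : ℕ) (u v : Fin (2 ^ n)) → u ≢ v →
           ¬ (∀ (k : ℕ) → tally (Tourn n) u k ≡ tally (Tourn n) v k)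
lemma7p5 zero    Fin.zero Fin.zero u≢v _    = u≢v refl
lemma7p5 (suc n) u        v        u≢v same = u≢v (Finₚ.toℕ-injective (begin
  toℕ u      ≡⟨ sym (n/1≡n (toℕ u)) ⟩
  toℕ u /2^ 0 ≡⟨ Equivalence.to (tallyPrefix≡⇔/2^≡ (suc n) n 0 (ℕₚ.+-comm n 1) u v)
                                (tallyPrefix-cong (Tourn (suc n)) same n) ⟩
  toℕ v /2^ 0 ≡⟨ n/1≡n (toℕ v) ⟩
  toℕ v      ∎))
  where open ≡-Reasoning
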